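{- For any integer $\gamma \geq 0$, the operad $\mathsf{DAs}_\gamma$ admits the following presentation. It is generated by $\mathfrak{G}'_{\mathsf{DAs}_\gamma} := \{\diamond_b : b \in [\gamma]\}$, where $\diamond_b := \sum_{a \in [b]} \lozenge_a$, and its space of relations $\mathfrak{R}'_{\mathsf{DAs}_\gamma}$ is generated by \begin{equation} \diamond_a \circ_1 \diamond_a - \diamond_a \circ_2 \diamond_a, \qquad a \in [\gamma]. \end{equation}
   Context: The ground field $\mathbb{K}$ has characteristic zero and $[\gamma] = \{1, \dots, \gamma\}$. For an integer $\gamma \geq 0$, $\mathsf{DAs}_\gamma$ is the nonsymmetric operad (Koszul dual of the $\gamma$-multiassociative operad $\mathsf{As}_\gamma$) generated by binary elements $\lozenge_a$, $a \in [\gamma]$, with space of relations generated by $\lozenge_b \circ_1 \lozenge_b - \lozenge_b \circ_2 \lozenge_b + \sum_{a < b} \left(\lozenge_a \circ_1 \lozenge_b + \lozenge_b \circ_1 \lozenge_a - \lozenge_a \circ_2 \lozenge_b - \lozenge_b \circ_2 \lozenge_a\right)$, $b \in [\gamma]$. The elements $\diamond_b := \sum_{a \in [b]} \lozenge_a$ of the free operad on the generators $\lozenge_a$ form, by triangularity, a basis of its arity-2 component and hence generate it. -}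

module Defs where

open import Level using (Level; _⊔_) renaming (suc to lsuc)
open import Data.Nat using (ℕ; zero; suc)
open import Data.Fin using (Fin; zero; suc; _<_; _<?_)
open import Data.Product using (Σ; _,_; ∃; ∃-syntax; _×_)
open import Relation.Nullary using (¬_; yes; no)
open import Algebra.Bundles using (CommutativeRing)

record IsField {c ℓ} (R : CommutativeRing c ℓ) : Set (c ⊔ ℓ) where
  open CommutativeRing R
  field
    1≉0     : ¬ (1# ≈ 0#)
    inverse : ∀ x → ¬ (x ≈ 0#) → ∃[ y ] (x * y ≈ 1#)

module _ {c ℓ} (R : CommutativeRing c ℓ) where
  open CommutativeRing R using (Carrier; _+_; 0#; 1#)
  natToRing : ℕ → Carrier
  natToRing zero    = 0#
  natToRing (suc n) = 1# + natToRing n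

CharZero : ∀ {c ℓ} (R : CommutativeRing c ℓ) → Set ℓ
CharZero R = ∀ n → ¬ (natToRing R (suc n) ≈ 0#)
  where open CommutativeRing R using (_≈_; 0#)

module FreeOperad {c ℓ} (K : CommutativeRing c ℓ) (γ : ℕ) where
  open CommutativeRing K using (Carrier; _≈_; _+_; _*_; _-_; 0#; 1#)

  Σᶠ : ∀ {n} → (Fin n → Carrier) → Carrier
  Σᶠ {zero}  f = 0#
  Σᶠ {suc n} f = f zero + Σᶠ (λ i → f (suc i))

  -- Arity-2 component of the free nonsymmetric operad on the binary
  -- generators ◇_a, a ∈ [γ] (indexed by Fin γ): coordinate vectors in
  -- the basis (◇_a)_a.
  Arity2 : Set c
  Arity2 = Fin γ → Carrier

  -- Arity-3 component: its basis consists of the trees ◇_a ∘_i ◇_b with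
  -- a, b ∈ [γ] and i ∈ {1,2} (i = zero ↔ ∘_1, i = suc zero ↔ ∘_2).
  -- An element is given by its coordinates in that basis.
  Arity3 : Set c
  Arity3 = Fin γ → Fin γ → Fin 2 → Carrier

  gen : Fin γ → Arity2
  gen a a' with a Data.Fin.≟ a'
  ... | yes _ = 1#
  ... | no  _ = 0#

  -- ⋄_b := Σ_{a ∈ [b]} ◇_a, i.e. coefficient 1 on ◇_a for a ≤ b.
  dgen : Fin γ → Arity2
  dgen b a with b <? a
  ... | yes _ = 0#
  ... | no  _ = 1#

  comp : Fin 2 → Arity2 → Arity2 → Arity3
  comp i x y a b j with i Data.Fin.≟ j
  ... | yes _ = x a * y b
  ... | no  _ = 0#

  _∘₁_ _∘₂_ : Arity2 → Arity2 → Arity3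
  x ∘₁ y = comp zero x y
  x ∘₂ y = comp (suc zero) x y

  _⊕_ _⊖_ : Arity3 → Arity3 → Arity3
  (u ⊕ v) a b j = u a b j + v a b j
  (u ⊖ v) a b j = u a b j - v a b j

  zero3 : Arity3
  zero3 _ _ _ = 0#

  ⨁ : (Fin γ → Arity3) → Arity3
  ⨁ f a b j = Σᶠ (λ k → f k a b j)

  rel : Fin γ → Arity3
  rel b = ((gen b ∘₁ gen b) ⊖ (gen b ∘₂ gen b)) ⊕ ⨁ term
    where
    term : Fin γ → Arity3
    term a with a <? b
    ... | yes _ = (((gen a ∘₁ gen b) ⊕ (gen b ∘₁ gen a))
                    ⊖ (gen a ∘₂ gen b)) ⊖ (gen b ∘₂ gen a)
    ... | no  _ = zero3

  rel' : Fin γ → Arity3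
  rel' a = (dgen a ∘₁ dgen a) ⊖ (dgen a ∘₂ dgen a)

  InSpan : (Fin γ → Arity3) → Arity3 → Set (c ⊔ ℓ)
  InSpan g v = Σ (Fin γ → Carrier) λ coeff → (∀ a b j → v a b j ≈ Σᶠ (λ k → coeff k * g k a b j))

  SameSpan : (Fin γ → Arity3) → (Fin γ → Arity3) → Set (c ⊔ ℓ)
  SameSpan g h = (∀ k → InSpan h (g k)) × (∀ k → InSpan g (h k))

{-# OPTIONS --safe #-}
-- Send an arity-2 element e to Σ_{x,y} e(max(x,y)) (◇_x ∘₁ ◇_y − ◇_x ∘₂ ◇_y).
-- This linear map takes ◇_b to the b-th relation of DAs_γ, whose coefficient on
-- ◇_x ∘₁ ◇_y is 1 exactly when max(x,y) = b, and it takes ⋄_a to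
-- ⋄_a ∘₁ ⋄_a − ⋄_a ∘₂ ⋄_a, because ⋄_a(x) ⋄_a(y) = ⋄_a(max(x,y)).
-- The unitriangular change of basis ⋄_b = Σ_{a ≤ b} ◇_a, ◇_b = ⋄_b − ⋄_{b−1}
-- therefore carries over to the relations.
module Submission where

open import Defs
open import Data.Nat using (ℕ)
open import Algebra.Bundles using (CommutativeRing)

import Data.Nat as ℕ
import Data.Nat.Properties as ℕ
open import Data.Fin using (Fin; zero; suc; toℕ; inject₁; punchIn; _≤_; _<_; _≤?_; _<?_; _≟_)
open import Data.Fin.Properties using (≤-totalOrder; <-cmp; <⇒≤pred; toℕ-inject₁; toℕ-injective; punchInᵢ≢i)
open import Data.Vec.Functional using (Vector)
open import Data.Product using (_×_; _,_; uncurry)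
open import Data.Sum using (inj₁; inj₂)
open import Data.Maybe using (nothing)
open import Function using (_∘_)
open import Relation.Binary.Definitions using (tri<; tri≈; tri>)
open import Relation.Binary.PropositionalEquality as ≡ using (_≡_; _≢_)
open import Relation.Nullary using (Dec; yes; no; ¬_; contradiction; _×-dec_)
open import Relation.Unary using (Pred; Decidable)
open import Tactic.RingSolver.Core.AlmostCommutativeRing using (fromCommutativeRing)

module Indicators {c ℓ} (K : CommutativeRing c ℓ) where
  open CommutativeRing K hiding (zero)
  open import Relation.Binary.Reasoning.Setoid setoid
  open import Algebra.Properties.Ring ring using (-1*x≈-x)
  open import Algebra.Properties.Semiring.Sum semiring public
    using (sum; sum-syntax; sum-cong-≋; ∑-distrib-+; *-distribˡ-sum)
  open import Algebra.Properties.Semiring.Sum semiring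
    using (sum-remove; sum-replicate-zero)

  𝟙 : ∀ {p} {A : Set p} → Dec A → Carrier
  𝟙 (yes _) = 1#
  𝟙 (no _)  = 0#

  𝟙-yes : ∀ {p} {A : Set p} → A → (a? : Dec A) → 𝟙 a? ≈ 1#
  𝟙-yes _ (yes _)  = refl
  𝟙-yes a (no ¬a)  = contradiction a ¬a

  𝟙-no : ∀ {p} {A : Set p} → ¬ A → (a? : Dec A) → 𝟙 a? ≈ 0#
  𝟙-no ¬a (yes a) = contradiction a ¬a
  𝟙-no _  (no _)  = refl

  𝟙-cong : ∀ {p q} {A : Set p} {B : Set q} → (A → B) → (B → A) →
           (a? : Dec A) (b? : Dec B) → 𝟙 a? ≈ 𝟙 b?
  𝟙-cong A→B _   (yes a)  b? = sym (𝟙-yes (A→B a) b?)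
  𝟙-cong _   B→A (no ¬a)  b? = sym (𝟙-no (¬a ∘ B→A) b?)

  𝟙-×-dec : ∀ {p q} {A : Set p} {B : Set q} (a? : Dec A) (b? : Dec B) →
            𝟙 (a? ×-dec b?) ≈ 𝟙 a? * 𝟙 b?
  𝟙-×-dec (yes _) (yes _) = sym (*-identityˡ 1#)
  𝟙-×-dec (yes _) (no _)  = sym (zeroʳ 1#)
  𝟙-×-dec (no _)  b?      = sym (zeroˡ (𝟙 b?))

  𝟙≤≈𝟙<+𝟙≡ : ∀ {n} (m k : Fin n) → 𝟙 (m ≤? k) ≈ 𝟙 (m <? k) + 𝟙 (k ≟ m)
  𝟙≤≈𝟙<+𝟙≡ m k with <-cmp m k
  ... | tri< m<k m≢k _ = begin
    𝟙 (m ≤? k)               ≈⟨ 𝟙-yes (ℕ.<⇒≤ m<k) (m ≤? k) ⟩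
    1#                       ≈⟨ +-identityʳ 1# ⟨
    1# + 0#                  ≈⟨ +-cong (𝟙-yes m<k (m <? k)) (𝟙-no (m≢k ∘ ≡.sym) (k ≟ m)) ⟨
    𝟙 (m <? k) + 𝟙 (k ≟ m)   ∎
  ... | tri≈ m≮k ≡.refl _ = begin
    𝟙 (m ≤? m)               ≈⟨ 𝟙-yes ℕ.≤-refl (m ≤? m) ⟩
    1#                       ≈⟨ +-identityˡ 1# ⟨
    0# + 1#                  ≈⟨ +-cong (𝟙-no m≮k (m <? m)) (𝟙-yes ≡.refl (m ≟ m)) ⟨
    𝟙 (m <? m) + 𝟙 (m ≟ m)   ∎
  ... | tri> m≮k m≢k k<m = begin
    𝟙 (m ≤? k)               ≈⟨ 𝟙-no (ℕ.<⇒≱ k<m) (m ≤? k) ⟩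
    0#                       ≈⟨ +-identityʳ 0# ⟨
    0# + 0#                  ≈⟨ +-cong (𝟙-no m≮k (m <? k)) (𝟙-no (m≢k ∘ ≡.sym) (k ≟ m)) ⟨
    𝟙 (m <? k) + 𝟙 (k ≟ m)   ∎

  sum-supported : ∀ {n} (t : Vector Carrier n) x → (∀ i → i ≢ x → t i ≈ 0#) → sum t ≈ t x
  sum-supported {ℕ.suc n} t x t≈0 = begin
    sum t                        ≈⟨ sum-remove {i = x} t ⟩
    t x + sum (t ∘ punchIn x)    ≈⟨ +-congˡ (sum-cong-≋ (λ j → t≈0 _ (punchInᵢ≢i x j))) ⟩
    t x + sum {n} (λ _ → 0#)     ≈⟨ +-congˡ (sum-replicate-zero n) ⟩
    t x + 0#                     ≈⟨ +-identityʳ (t x) ⟩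
    t x                          ∎

  sum-sift : ∀ {n} (f : Vector Carrier n) x → sum (λ i → f i * 𝟙 (i ≟ x)) ≈ f x
  sum-sift f x = begin
    sum (λ i → f i * 𝟙 (i ≟ x))   ≈⟨ sum-supported _ x off-support ⟩
    f x * 𝟙 (x ≟ x)               ≈⟨ *-congˡ (𝟙-yes ≡.refl (x ≟ x)) ⟩
    f x * 1#                      ≈⟨ *-identityʳ (f x) ⟩
    f x                           ∎
    where
    off-support : ∀ i → i ≢ x → f i * 𝟙 (i ≟ x) ≈ 0#
    off-support i i≢x = trans (*-congˡ (𝟙-no i≢x (i ≟ x))) (zeroʳ (f i))

  sum-neg : ∀ {n} (f : Vector Carrier n) → sum (λ i → - f i) ≈ - sum f
  sum-neg f = begin
    sum (λ i → - f i)          ≈⟨ sum-cong-≋ (λ i → -1*x≈-x (f i)) ⟨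
    sum (λ i → - 1# * f i)     ≈⟨ *-distribˡ-sum (- 1#) f ⟨
    - 1# * sum f               ≈⟨ -1*x≈-x (sum f) ⟩
    - sum f                    ∎

  𝟙<≈∑predecessor : ∀ {n} (m k : Fin n) →
    𝟙 (m <? k) ≈ ∑[ i < n ] (𝟙 (toℕ k ℕ.≟ ℕ.suc (toℕ i)) * 𝟙 (m ≤? i))
  𝟙<≈∑predecessor {ℕ.suc n} m zero = begin
    𝟙 (m <? zero {n})           ≈⟨ 𝟙-no (λ ()) (m <? zero {n}) ⟩
    0#                          ≈⟨ sum-replicate-zero (ℕ.suc n) ⟨
    sum {ℕ.suc n} (λ _ → 0#)    ≈⟨ sum-cong-≋ {ℕ.suc n} vanishing ⟨
    ∑[ i < ℕ.suc n ] (𝟙 (0 ℕ.≟ ℕ.suc (toℕ i)) * 𝟙 (m ≤? i)) ∎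
    where
    vanishing : ∀ i → 𝟙 (0 ℕ.≟ ℕ.suc (toℕ i)) * 𝟙 (m ≤? i) ≈ 0#
    vanishing i = trans (*-congʳ (𝟙-no (λ ()) (0 ℕ.≟ ℕ.suc (toℕ i)))) (zeroˡ (𝟙 (m ≤? i)))
  𝟙<≈∑predecessor {ℕ.suc n} m (suc k) = sym (begin
    sum t                    ≈⟨ sum-supported t (inject₁ k) off-support ⟩
    t (inject₁ k)            ≈⟨ *-congʳ (𝟙-yes k≡k (ℕ.suc (toℕ k) ℕ.≟ ℕ.suc (toℕ (inject₁ k)))) ⟩
    1# * 𝟙 (m ≤? inject₁ k)  ≈⟨ *-identityˡ _ ⟩
    𝟙 (m ≤? inject₁ k)       ≈⟨ 𝟙-cong m≤k⇒m<1+k <⇒≤pred (m ≤? inject₁ k) (m <? suc k) ⟩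
    𝟙 (m <? suc k)           ∎)
    where
    t : Vector Carrier (ℕ.suc n)
    t i = 𝟙 (ℕ.suc (toℕ k) ℕ.≟ ℕ.suc (toℕ i)) * 𝟙 (m ≤? i)
    k≡k : ℕ.suc (toℕ k) ≡ ℕ.suc (toℕ (inject₁ k))
    k≡k = ≡.cong ℕ.suc (≡.sym (toℕ-inject₁ k))
    off-support : ∀ i → i ≢ inject₁ k → t i ≈ 0#
    off-support i i≢k = trans (*-congʳ (𝟙-no k≢i (ℕ.suc (toℕ k) ℕ.≟ ℕ.suc (toℕ i)))) (zeroˡ _)
      where
      k≢i : ℕ.suc (toℕ k) ≢ ℕ.suc (toℕ i)
      k≢i e = i≢k (toℕ-injective (≡.trans (≡.sym (ℕ.suc-injective e)) (≡.sym (toℕ-inject₁ k))))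
    m≤k⇒m<1+k : m ≤ inject₁ k → m < suc k
    m≤k⇒m<1+k m≤k = ℕ.s≤s (ℕ.≤-trans m≤k (ℕ.≤-reflexive (toℕ-inject₁ k)))

module RingIdentities {c ℓ} (K : CommutativeRing c ℓ) where
  open CommutativeRing K
  open import Tactic.RingSolver.NonReflective (fromCommutativeRing K (λ _ → nothing))
    using (solve; _⊜_; _⊕_; _⊗_; ⊝_)
  open import Algebra.Properties.Ring ring using (-1*x≈-x; -‿distribˡ-*)
  open import Algebra.Properties.Group +-group using (ε⁻¹≈ε)

  x-0≈1*x : ∀ x → x - 0# ≈ 1# * x
  x-0≈1*x x = trans (+-congˡ ε⁻¹≈ε) (trans (+-identityʳ x) (sym (*-identityˡ x)))

  0-x≈-1*x : ∀ x → 0# - x ≈ - 1# * x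
  0-x≈-1*x x = trans (+-identityˡ (- x)) (sym (-1*x≈-x x))

  [a+b-c]-d≈[a-c]+[b-d] : ∀ a b c d → ((a + b) - c) - d ≈ (a - c) + (b - d)
  [a+b-c]-d≈[a-c]+[b-d] =
    solve 4 (λ a b c d → (((a ⊕ b) ⊕ ⊝ c) ⊕ ⊝ d) ⊜ ((a ⊕ ⊝ c) ⊕ (b ⊕ ⊝ d))) refl

  [a-b]*c≈c*a-b*c : ∀ a b c → (a - b) * c ≈ c * a + - (b * c)
  [a-b]*c≈c*a-b*c a b c = trans (distribʳ c a (- b)) (+-cong (*-comm a c) (sym (-‿distribˡ-* b c)))

  p*[a*b+c*a′]≈[p*b]*a+[c*p]*a′ : ∀ p a b c a′ → p * (a * b + c * a′) ≈ (p * b) * a + (c * p) * a′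
  p*[a*b+c*a′]≈[p*b]*a+[c*p]*a′ p a b c a′ = trans (distribˡ p (a * b) (c * a′)) (+-cong
    (trans (*-congˡ (*-comm a b)) (sym (*-assoc p b a)))
    (trans (sym (*-assoc p c a′)) (*-congʳ (*-comm p c))))

  [p+d]*[q+e]≈pq+[de+[pe+dq]] : ∀ p d q e → (p + d) * (q + e) ≈ p * q + (d * e + (p * e + d * q))
  [p+d]*[q+e]≈pq+[de+[pe+dq]] =
    solve 4 (λ p d q e → ((p ⊕ d) ⊗ (q ⊕ e)) ⊜ (p ⊗ q ⊕ (d ⊗ e ⊕ (p ⊗ e ⊕ d ⊗ q)))) refl

module Relations {c ℓ} (K : CommutativeRing c ℓ) (γ : ℕ) where
  open CommutativeRing K hiding (zero)
  open import Relation.Binary.Reasoning.Setoid setoid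
  open import Algebra.Properties.AbelianGroup +-abelianGroup using (xyx⁻¹≈y)
  open import Algebra.Properties.CommutativeSemigroup *-commutativeSemigroup using (x∙yz≈y∙xz)
  open import Algebra.Construct.NaturalChoice.Max (≤-totalOrder γ) using (_⊔_; maxOperator)
  open import Algebra.Construct.NaturalChoice.MaxOp maxOperator using (x≤x⊔y; x≤y⊔x; ⊔-sel)
  open Indicators K
  open RingIdentities K
  open FreeOperad K γ

  Σᶠ≈sum : ∀ {n} {f g : Vector Carrier n} → (∀ i → f i ≈ g i) → Σᶠ f ≈ sum g
  Σᶠ≈sum {ℕ.zero}  _   = refl
  Σᶠ≈sum {ℕ.suc n} f≈g = +-cong (f≈g zero) (Σᶠ≈sum (f≈g ∘ suc))

  gen≡𝟙 : ∀ a x → gen a x ≡ 𝟙 (a ≟ x)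
  gen≡𝟙 a x with a ≟ x
  ... | yes _ = ≡.refl
  ... | no _  = ≡.refl

  dgen≈𝟙 : ∀ a x → dgen a x ≈ 𝟙 (x ≤? a)
  dgen≈𝟙 a x with a <? x
  ... | yes a<x = sym (𝟙-no (ℕ.<⇒≱ a<x) (x ≤? a))
  ... | no a≮x  = sym (𝟙-yes (ℕ.≮⇒≥ a≮x) (x ≤? a))

  sum-gen : ∀ (f : Arity2) m → ∑[ i < γ ] (f i * gen i m) ≈ f m
  sum-gen f m = trans (sum-cong-≋ (λ i → *-congˡ (reflexive (gen≡𝟙 i m)))) (sum-sift f m)

  dgen≈𝟙<+gen : ∀ a m → dgen a m ≈ 𝟙 (m <? a) + gen a m
  dgen≈𝟙<+gen a m = begin
    dgen a m                  ≈⟨ dgen≈𝟙 a m ⟩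
    𝟙 (m ≤? a)                ≈⟨ 𝟙≤≈𝟙<+𝟙≡ m a ⟩
    𝟙 (m <? a) + 𝟙 (a ≟ m)    ≡⟨ ≡.cong (𝟙 (m <? a) +_) (gen≡𝟙 a m) ⟨
    𝟙 (m <? a) + gen a m      ∎

  dgen-𝟙<≈gen : ∀ a m → dgen a m - 𝟙 (m <? a) ≈ gen a m
  dgen-𝟙<≈gen a m = trans (+-congʳ (dgen≈𝟙<+gen a m)) (xyx⁻¹≈y (𝟙 (m <? a)) (gen a m))

  dgen≈∑gen : ∀ k m → dgen k m ≈ ∑[ i < γ ] (dgen k i * gen i m)
  dgen≈∑gen k m = sym (sum-gen (dgen k) m)

  gen≈∑dgen : ∀ k m →
    gen k m ≈ ∑[ i < γ ] ((gen i k - 𝟙 (toℕ k ℕ.≟ ℕ.suc (toℕ i))) * dgen i m)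
  gen≈∑dgen k m = sym (begin
    ∑[ i < γ ] ((gen i k - pred i) * dgen i m)
      ≈⟨ sum-cong-≋ (λ i → [a-b]*c≈c*a-b*c (gen i k) (pred i) (dgen i m)) ⟩
    ∑[ i < γ ] (dgen i m * gen i k + - (pred i * dgen i m))
      ≈⟨ ∑-distrib-+ (λ i → dgen i m * gen i k) (λ i → - (pred i * dgen i m)) ⟩
    ∑[ i < γ ] (dgen i m * gen i k) + ∑[ i < γ ] (- (pred i * dgen i m))
      ≈⟨ +-cong (sum-gen (λ i → dgen i m) k) (sum-neg (λ i → pred i * dgen i m)) ⟩
    dgen k m - ∑[ i < γ ] (pred i * dgen i m)
      ≈⟨ +-congˡ (-‿cong (sum-cong-≋ (λ i → *-congˡ (dgen≈𝟙 i m)))) ⟩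
    dgen k m - ∑[ i < γ ] (pred i * 𝟙 (m ≤? i))
      ≈⟨ +-congˡ (-‿cong (𝟙<≈∑predecessor m k)) ⟨
    dgen k m - 𝟙 (m <? k)
      ≈⟨ dgen-𝟙<≈gen k m ⟩
    gen k m ∎)
    where
    pred : Fin γ → Carrier
    pred i = 𝟙 (toℕ k ℕ.≟ ℕ.suc (toℕ i))

  𝟙-⊔ : ∀ {p} {P : Pred (Fin γ) p} → (∀ {u v} → u ≤ v → P v → P u) → (P? : Decidable P) →
        ∀ x y → 𝟙 (P? (x ⊔ y)) ≈ 𝟙 (P? x) * 𝟙 (P? y)
  𝟙-⊔ {P = P} downward P? x y =
    trans (𝟙-cong both (uncurry either) (P? (x ⊔ y)) (P? x ×-dec P? y)) (𝟙-×-dec (P? x) (P? y))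
    where
    both : P (x ⊔ y) → P x × P y
    both p = downward (x≤x⊔y x y) p , downward (x≤y⊔x x y) p
    either : P x → P y → P (x ⊔ y)
    either px py with ⊔-sel x y
    ... | inj₁ x⊔y≡x = ≡.subst P (≡.sym x⊔y≡x) px
    ... | inj₂ x⊔y≡y = ≡.subst P (≡.sym x⊔y≡y) py

  dgen-⊔ : ∀ a x y → dgen a x * dgen a y ≈ dgen a (x ⊔ y)
  dgen-⊔ a x y = begin
    dgen a x * dgen a y          ≈⟨ *-cong (dgen≈𝟙 a x) (dgen≈𝟙 a y) ⟩
    𝟙 (x ≤? a) * 𝟙 (y ≤? a)      ≈⟨ 𝟙-⊔ ℕ.≤-trans (_≤? a) x y ⟨
    𝟙 (x ⊔ y ≤? a)               ≈⟨ dgen≈𝟙 a (x ⊔ y) ⟨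
    dgen a (x ⊔ y)               ∎

  sign : Fin 2 → Carrier
  sign zero    = 1#
  sign (suc _) = - 1#

  maxAssociator : Arity2 → Arity3
  maxAssociator e x y j = sign j * e (x ⊔ y)

  ∘₁⊖∘₂≈sign : ∀ u v x y j → ((u ∘₁ v) ⊖ (u ∘₂ v)) x y j ≈ sign j * (u x * v y)
  ∘₁⊖∘₂≈sign u v x y zero       = x-0≈1*x (u x * v y)
  ∘₁⊖∘₂≈sign u v x y (suc zero) = 0-x≈-1*x (u x * v y)

  rel'≈maxAssociator : ∀ a x y j → rel' a x y j ≈ maxAssociator (dgen a) x y j
  rel'≈maxAssociator a x y j = trans (∘₁⊖∘₂≈sign (dgen a) (dgen a) x y j) (*-congˡ (dgen-⊔ a x y))

  rel≈∑summands : ∀ b x y j → rel b x y j ≈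
    sign j * (gen b x * gen b y) + ∑[ a < γ ] (sign j * (𝟙 (a <? b) * (gen a x * gen b y + gen b x * gen a y)))
  -- The summand of rel is local to its definition in Defs and cannot be named; unification supplies it.
  rel-summand : ∀ b x y j a → _ ≈ sign j * (𝟙 (a <? b) * (gen a x * gen b y + gen b x * gen a y))
  rel≈∑summands b x y j = +-cong (∘₁⊖∘₂≈sign (gen b) (gen b) x y j) (Σᶠ≈sum (rel-summand b x y j))
  rel-summand b x y j a with a <? b
  ... | yes _ = begin
    ((((gen a ∘₁ gen b) ⊕ (gen b ∘₁ gen a)) ⊖ (gen a ∘₂ gen b)) ⊖ (gen b ∘₂ gen a)) x y j
      ≈⟨ [a+b-c]-d≈[a-c]+[b-d] _ _ _ _ ⟩
    ((gen a ∘₁ gen b) ⊖ (gen a ∘₂ gen b)) x y j + ((gen b ∘₁ gen a) ⊖ (gen b ∘₂ gen a)) x y j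
      ≈⟨ +-cong (∘₁⊖∘₂≈sign (gen a) (gen b) x y j) (∘₁⊖∘₂≈sign (gen b) (gen a) x y j) ⟩
    sign j * (gen a x * gen b y) + sign j * (gen b x * gen a y)
      ≈⟨ distribˡ (sign j) _ _ ⟨
    sign j * (gen a x * gen b y + gen b x * gen a y)
      ≈⟨ *-congˡ (*-identityˡ _) ⟨
    sign j * (1# * (gen a x * gen b y + gen b x * gen a y)) ∎
  ... | no _  = sym (trans (*-congˡ (zeroˡ _)) (zeroʳ (sign j)))

  ∑-lower-summands : ∀ b x y →
    ∑[ a < γ ] (𝟙 (a <? b) * (gen a x * gen b y + gen b x * gen a y)) ≈
    𝟙 (x <? b) * gen b y + gen b x * 𝟙 (y <? b)
  ∑-lower-summands b x y = begin
    ∑[ a < γ ] (𝟙 (a <? b) * (gen a x * gen b y + gen b x * gen a y))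
      ≈⟨ sum-cong-≋ (λ a → p*[a*b+c*a′]≈[p*b]*a+[c*p]*a′ (𝟙 (a <? b)) (gen a x) (gen b y) (gen b x) (gen a y)) ⟩
    ∑[ a < γ ] ((𝟙 (a <? b) * gen b y) * gen a x + (gen b x * 𝟙 (a <? b)) * gen a y)
      ≈⟨ ∑-distrib-+ (λ a → (𝟙 (a <? b) * gen b y) * gen a x) (λ a → (gen b x * 𝟙 (a <? b)) * gen a y) ⟩
    ∑[ a < γ ] ((𝟙 (a <? b) * gen b y) * gen a x) + ∑[ a < γ ] ((gen b x * 𝟙 (a <? b)) * gen a y)
      ≈⟨ +-cong (sum-gen (λ a → 𝟙 (a <? b) * gen b y) x) (sum-gen (λ a → gen b x * 𝟙 (a <? b)) y) ⟩
    𝟙 (x <? b) * gen b y + gen b x * 𝟙 (y <? b) ∎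

  rel≈sign*expansion : ∀ b x y j →
    rel b x y j ≈ sign j * (gen b x * gen b y + (𝟙 (x <? b) * gen b y + gen b x * 𝟙 (y <? b)))
  rel≈sign*expansion b x y j = begin
    rel b x y j
      ≈⟨ rel≈∑summands b x y j ⟩
    sign j * (gen b x * gen b y) + ∑[ a < γ ] (sign j * (𝟙 (a <? b) * (gen a x * gen b y + gen b x * gen a y)))
      ≈⟨ +-congˡ (*-distribˡ-sum (sign j) (λ a → 𝟙 (a <? b) * (gen a x * gen b y + gen b x * gen a y))) ⟨
    sign j * (gen b x * gen b y) + sign j * ∑[ a < γ ] (𝟙 (a <? b) * (gen a x * gen b y + gen b x * gen a y))
      ≈⟨ +-congˡ (*-congˡ (∑-lower-summands b x y)) ⟩
    sign j * (gen b x * gen b y) + sign j * (𝟙 (x <? b) * gen b y + gen b x * 𝟙 (y <? b))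
      ≈⟨ distribˡ (sign j) _ _ ⟨
    sign j * (gen b x * gen b y + (𝟙 (x <? b) * gen b y + gen b x * 𝟙 (y <? b))) ∎

  gen-⊔ : ∀ b x y → gen b x * gen b y + (𝟙 (x <? b) * gen b y + gen b x * 𝟙 (y <? b)) ≈ gen b (x ⊔ y)
  gen-⊔ b x y = begin
    δx * δy + (px * δy + δx * py)              ≈⟨ xyx⁻¹≈y (px * py) _ ⟨
    px * py + (δx * δy + (px * δy + δx * py)) - px * py
      ≈⟨ +-congʳ ([p+d]*[q+e]≈pq+[de+[pe+dq]] px δx py δy) ⟨
    (px + δx) * (py + δy) - px * py
      ≈⟨ +-cong (*-cong (dgen≈𝟙<+gen b x) (dgen≈𝟙<+gen b y)) (-‿cong (𝟙-⊔ ℕ.≤-<-trans (_<? b) x y)) ⟨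
    dgen b x * dgen b y - 𝟙 (x ⊔ y <? b)       ≈⟨ +-congʳ (dgen-⊔ b x y) ⟩
    dgen b (x ⊔ y) - 𝟙 (x ⊔ y <? b)            ≈⟨ dgen-𝟙<≈gen b (x ⊔ y) ⟩
    gen b (x ⊔ y)                              ∎
    where
    δx δy px py : Carrier
    δx = gen b x
    δy = gen b y
    px = 𝟙 (x <? b)
    py = 𝟙 (y <? b)

  rel≈maxAssociator : ∀ b x y j → rel b x y j ≈ maxAssociator (gen b) x y j
  rel≈maxAssociator b x y j = trans (rel≈sign*expansion b x y j) (*-congˡ (gen-⊔ b x y))

  InSpan-maxAssociator : ∀ {g : Fin γ → Arity3} {v : Arity3} {e : Fin γ → Arity2} {w : Arity2}
    {coeff : Fin γ → Carrier} →
    (∀ i x y j → g i x y j ≈ maxAssociator (e i) x y j) →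
    (∀ x y j → v x y j ≈ maxAssociator w x y j) →
    (∀ m → w m ≈ ∑[ i < γ ] (coeff i * e i m)) →
    InSpan g v
  InSpan-maxAssociator {g} {v} {e} {w} {coeff} g≈ v≈ w≈ = coeff , λ x y j → begin
    v x y j
      ≈⟨ v≈ x y j ⟩
    sign j * w (x ⊔ y)
      ≈⟨ *-congˡ (w≈ (x ⊔ y)) ⟩
    sign j * ∑[ i < γ ] (coeff i * e i (x ⊔ y))
      ≈⟨ *-distribˡ-sum (sign j) (λ i → coeff i * e i (x ⊔ y)) ⟩
    ∑[ i < γ ] (sign j * (coeff i * e i (x ⊔ y)))
      ≈⟨ sum-cong-≋ (λ i → x∙yz≈y∙xz (sign j) (coeff i) (e i (x ⊔ y))) ⟩
    ∑[ i < γ ] (coeff i * maxAssociator (e i) x y j)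
      ≈⟨ Σᶠ≈sum (λ i → *-congˡ (g≈ i x y j)) ⟨
    Σᶠ (λ i → coeff i * g i x y j) ∎

-- The change of basis is unitriangular.
proposition3p1p3 : ∀ {c ℓ} (K : CommutativeRing c ℓ) → IsField K → CharZero K →
    (γ : ℕ) → FreeOperad.SameSpan K γ (FreeOperad.rel K γ) (FreeOperad.rel' K γ)
proposition3p1p3 K _ _ γ =
  (λ b → InSpan-maxAssociator rel'≈maxAssociator (rel≈maxAssociator b) (gen≈∑dgen b)) ,
  (λ a → InSpan-maxAssociator rel≈maxAssociator (rel'≈maxAssociator a) (dgen≈∑gen a))
  where open Relations K γ
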